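{- Let $(V,E)$ be a connected interval graph with representation $(L,<_L,f_L,f_R)$, and let $v,u\in V$ with $\neg\,v\,E\,u$ and $F(v)<_L F(u)$. Let $x,z\in B(v,u)$ and $m=\max\{e_x,e_z\}$. Assume $F(z)<_L F(x)$ and $F(v)\nless_L F(x)$. Then there exist a minimal path $z\,E\,v_1\,E\cdots E\,v_n\,E\,x$ and $s\in B(v,u)$ with $e_s<m$ such that $e_{v_i}<m$ and $F(v_i)<_L F(s)$ for each $i\le n$. Analogously, if $F(x)<_L F(z)$ and $F(x)\nless_L F(u)$, there exist a minimal path $x\,E\,v_1\,E\cdots E\,v_n\,E\,z$ and $s\in B(v,u)$ with $e_s<m$ such that $e_{v_i}<m$ and $F(s)<_L F(v_i)$ for each $i\le n$.
   Context: An interval graph with representation $(L,<_L,f_L,f_R)$ is a reflexive graph $(V,E)$ ($E$ symmetric) with a linear order $(L,<_L)$ and maps $f_L,f_R\colon V\to L$, $f_L(w)\le_L f_R(w)$, such that with $F(w)=\{\ell\mid f_L(w)\le_L\ell\le_L f_R(w)\}$, $w\,E\,w'\iff F(w)\cap F(w')\neq\emptyset$. $F(a)<_L F(b)$ means $f_R(a)<_L f_L(b)$ and $F(a)\nless_L F(b)$ is its negation. Connected means any two vertices are joined by a path. A path $w_0\,E\,w_1\,E\cdots E\,w_k$ is minimal if $\neg\,w_i\,E\,w_j$ whenever $i+1<j\le k$. For $v,u$ with $\neg\,v\,E\,u$: $B_0(v,u)=\{v,u\}$, $B_{n+1}(v,u)=\{w\in V\mid\exists y,y'\in B_n(v,u)\,(y\,E\,w\wedge\neg\,y'\,E\,w)\}$,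 $B(v,u)=\bigcup_n B_n(v,u)$, and for $w\in B(v,u)$, $e_w$ is the least $n$ with $w\in B_n(v,u)$. -}

module Defs where

open import Level using (0ℓ)
open import Data.Nat using (ℕ; zero; suc; _<_; _≤_; _⊔_)
open import Data.Product using (Σ; ∃; ∃-syntax; _×_; _,_)
open import Data.Sum using (_⊎_)
open import Relation.Nullary using (¬_)
open import Relation.Binary.Core using (Rel)
open import Relation.Binary.Structures using (IsStrictTotalOrder)
open import Relation.Binary.PropositionalEquality using (_≡_)

_≤[_]_ : {L : Set} → L → Rel L 0ℓ → L → Set
a ≤[ _<_ ] b = (a < b) ⊎ (a ≡ b)

record IntervalGraph : Set₁ where
  field
    V      : Set
    _E_    : V → V → Set
    E-refl : ∀ w → w E w
    E-sym  : ∀ {w w'} → w E w' → w' E w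
    L      : Set
    _<L_   : Rel L 0ℓ
    <L-isStrictTotalOrder : IsStrictTotalOrder _≡_ _<L_
    fL fR  : V → L
    fL≤fR  : ∀ w → fL w ≤[ _<L_ ] fR w

  _≤L_ : L → L → Set
  a ≤L b = a ≤[ _<L_ ] b

  _∈F_ : L → V → Set
  ℓ ∈F w = (fL w ≤L ℓ) × (ℓ ≤L fR w)

  _<F_ : V → V → Set
  a <F b = fR a <L fL b

  -- a walk of length k (k edges) from a to b given by w 0 , … , w k
  IsWalk : ℕ → (ℕ → V) → V → V → Set
  IsWalk k w a b = (w 0 ≡ a) × (w k ≡ b) × (∀ i → i < k → w i E w (suc i))

  IsMinimal : ℕ → (ℕ → V) → Set
  IsMinimal k w = ∀ i j → suc i < j → j ≤ k → ¬ (w i E w j)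

  Connected : Set
  Connected = ∀ a b → ∃[ k ] ∃[ w ] IsWalk k w a b

  B : V → V → ℕ → V → Set
  B v u zero    w = (w ≡ v) ⊎ (w ≡ u)
  B v u (suc n) w = ∃[ y ] ∃[ y' ] (B v u n y × B v u n y' × (y E w) × ¬ (y' E w))

  IsE : V → V → V → ℕ → Set
  IsE v u w n = B v u n w × (∀ k → k < n → ¬ B v u k w)

IsRepresentation : IntervalGraph → Set
IsRepresentation G = ∀ w w' →
    ((w E w') → ∃[ ℓ ] ((ℓ ∈F w) × (ℓ ∈F w'))) ×
    (∃[ ℓ ] ((ℓ ∈F w) × (ℓ ∈F w')) → (w E w'))
  where open IntervalGraph G

-- Let m = n + 1; z ∉ B₀ because F(v) and F(u) do not lie left of F(x). The walk
-- from z towards x is built greedily while a candidate d ∈ Bₖ descends through the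
-- levels k ≤ n, never lying right of the current end c of the walk. If d misses c it
-- lies left of c and is replaced by a neighbour in Bₖ₋₁; if d meets c and lies left of
-- x it is appended and replaced by a neighbour in Bₖ₋₁; otherwise d meets x, and a
-- non-neighbour of d in Bₖ₋₁ either lies right of d, giving s, or left of d, becoming
-- the new candidate. At level 0 the candidate must be v, and s = u. Every vertex used
-- lies in Bₙ, so its index is below m, and a shortest such walk is minimal. The second
-- half is the first one for the mirror image of the representation, with v and u
-- exchanged.
module Submission where

open import Defs
open import Level using (0ℓ)
open import Axiom.ExcludedMiddle using (ExcludedMiddle)
open import Data.Nat using (ℕ; zero; suc; _+_; _∸_; _<_; _≤_; _⊔_; z≤n; s≤s; _≤?_; _≤′_; ≤′-refl; ≤′-step)
open import Data.Nat.Properties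
  using (≤-refl; ≤-trans; <-trans; ≤-<-trans; <-≤-trans; <⇒≤; ≤⇒≯; <-cmp; ≤-<-connex; ≤⇒≤′;
         m≤m+n; m≤n⊔m; m<n⇒m<1+n; n∸n≡0; m∸n≤m; +-∸-assoc; ∸-monoʳ-<; m<n⇒0<n∸m; m+[n∸m]≡n;
         m∸n+n≡m; m+n≤o⇒m≤o∸n; m≤o∸n⇒m+n≤o)
open import Data.Nat.Induction using (<-rec)
open import Data.Product using (∃-syntax; _×_; _,_; proj₁; proj₂)
open import Data.Sum as Sum using (_⊎_; inj₁; inj₂)
open import Function using (id; flip; _∘_)
open import Relation.Nullary using (¬_; yes; no; contradiction)
open import Relation.Unary using (_∩_)
open import Relation.Binary.Bundles using (StrictTotalOrder)
open import Relation.Binary.Definitions using (tri<; tri≈; tri>)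
open import Relation.Binary.PropositionalEquality using (_≡_; refl; sym; trans; cong; subst; subst₂)
import Relation.Binary.Construct.Flip.EqAndOrd as Flip
import Relation.Binary.Construct.StrictToNonStrict as StrictToNonStrict
import Relation.Binary.Reasoning.StrictPartialOrder as StrictReasoning

Least : (ℕ → Set) → ℕ → Set
Least P n = P n × (∀ k → k < n → ¬ P k)

least-below : ExcludedMiddle 0ℓ → {P : ℕ → Set} → ∀ {n} → P n → ∃[ e ] (Least P e × e ≤ n)
least-below lem {P} {n} = <-rec (λ n → P n → ∃[ e ] (Least P e × e ≤ n)) step n
  where
  step : ∀ n → (∀ {k} → k < n → P k → ∃[ e ] (Least P e × e ≤ k)) →
         P n → ∃[ e ] (Least P e × e ≤ n)
  step n below pn with lem {∃[ k ] (k < n × P k)}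
  ... | yes (k , k<n , pk) =
    let e , e-least , e≤k = below k<n pk in e , e-least , ≤-trans e≤k (<⇒≤ k<n)
  ... | no ∄smaller        = n , (pn , λ k k<n pk → ∄smaller (k , k<n , pk)) , ≤-refl

jump : ℕ → ℕ → ℕ → ℕ
jump i d l with l ≤? i
... | yes _ = l
... | no  _ = l + d

jump-≤ : ∀ i d {l} → l ≤ i → jump i d l ≡ l
jump-≤ i d {l} l≤i with l ≤? i
... | yes _  = refl
... | no l≰i = contradiction l≤i l≰i

jump-> : ∀ i d {l} → i < l → jump i d l ≡ l + d
jump-> i d {l} i<l with l ≤? i
... | yes l≤i = contradiction i<l (≤⇒≯ l≤i)
... | no _    = refl

module Walks (G : IntervalGraph) where
  open IntervalGraph G

  Interior : ℕ → (ℕ → V) → (V → Set) → Set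
  Interior k w Q = ∀ i → 1 ≤ i → i < k → Q (w i)

  Interior-map : ∀ {k w} {Q R : V → Set} → (∀ {y} → Q y → R y) → Interior k w Q → Interior k w R
  Interior-map f int i 1≤i i<k = f (int i 1≤i i<k)

  WalkVia : (V → Set) → V → V → ℕ → Set
  WalkVia Q a b k = ∃[ w ] (IsWalk k w a b × Interior k w Q)

  cons : V → (ℕ → V) → ℕ → V
  cons a w zero    = a
  cons a w (suc i) = w i

  IsWalk-cons : ∀ {k w a b c} → a E b → IsWalk k w b c → IsWalk (suc k) (cons a w) a c
  IsWalk-cons aEb (refl , end , edges) = refl , end , λ where
    zero    _         → aEb
    (suc i) (s≤s i<k) → edges i i<k

  reverse : ℕ → (ℕ → V) → ℕ → V
  reverse k w i = w (k ∸ i)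

  IsWalk-reverse : ∀ {k w a b} → IsWalk k w a b → IsWalk k (reverse k w) b a
  IsWalk-reverse {k} {w} (start , end , edges) = end , trans (cong w (n∸n≡0 k)) start , edges′
    where
    edges′ : ∀ i → i < k → w (k ∸ i) E w (k ∸ suc i)
    edges′ i i<k = subst (λ j → w j E w (k ∸ suc i)) (sym k∸i≡1+k∸1+i)
                     (E-sym (edges (k ∸ suc i) (subst (_≤ k) k∸i≡1+k∸1+i (m∸n≤m k i))))
      where k∸i≡1+k∸1+i = +-∸-assoc 1 i<k

  Interior-reverse : ∀ {k w Q} → Interior k w Q → Interior k (reverse k w) Q
  Interior-reverse {k} int (suc i) _ 1+i<k =
    int (k ∸ suc i) (m<n⇒0<n∸m 1+i<k) (∸-monoʳ-< (s≤s z≤n) (<⇒≤ 1+i<k))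

  module _ {k : ℕ} {w : ℕ → V} {a b : V} {Q : V → Set} where
    shortcut : IsWalk k w a b → Interior k w Q → ∀ {i j} → suc i < j → j ≤ k → w i E w j →
               ∃[ k′ ] (k′ < k × WalkVia Q a b k′)
    shortcut (start , end , edges) int {i} {j} 1+i<j j≤k chord =
      k ∸ d , k∸d<k , (w ∘ jump i d) , (start′ , end′ , edges′) , int′
      where
      d = j ∸ suc i
      d≤k : d ≤ k
      d≤k = ≤-trans (m∸n≤m j (suc i)) j≤k
      k∸d<k : k ∸ d < k
      k∸d<k = ∸-monoʳ-< (m<n⇒0<n∸m 1+i<j) d≤k
      1+i+d≡j : suc i + d ≡ j
      1+i+d≡j = m+[n∸m]≡n (<⇒≤ 1+i<j)
      i<k : i < k
      i<k = <⇒≤ (<-≤-trans 1+i<j j≤k)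
      i<k∸d : i < k ∸ d
      i<k∸d = m+n≤o⇒m≤o∸n (suc i) (subst (_≤ k) (sym 1+i+d≡j) j≤k)
      shifted<k : ∀ {l} → l < k ∸ d → l + d < k
      shifted<k l<k∸d = m≤o∸n⇒m+n≤o (suc _) d≤k l<k∸d
      start′ : w (jump i d 0) ≡ a
      start′ = trans (cong w (jump-≤ i d z≤n)) start
      end′ : w (jump i d (k ∸ d)) ≡ b
      end′ = trans (cong w (trans (jump-> i d i<k∸d) (m∸n+n≡m d≤k))) end
      edges′ : ∀ l → l < k ∸ d → w (jump i d l) E w (jump i d (suc l))
      edges′ l l<k∸d with <-cmp l i
      ... | tri< l<i _ _ =
        subst₂ (λ p q → w p E w q) (sym (jump-≤ i d (<⇒≤ l<i))) (sym (jump-≤ i d l<i))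
          (edges l (<-trans l<i i<k))
      ... | tri≈ _ refl _ =
        subst₂ (λ p q → w p E w q) (sym (jump-≤ i d ≤-refl)) (sym (trans (jump-> i d ≤-refl) 1+i+d≡j))
          chord
      ... | tri> _ _ i<l =
        subst₂ (λ p q → w p E w q) (sym (jump-> i d i<l)) (sym (jump-> i d (m<n⇒m<1+n i<l)))
          (edges (l + d) (shifted<k l<k∸d))
      int′ : Interior (k ∸ d) (w ∘ jump i d) Q
      int′ l 1≤l l<k∸d with ≤-<-connex l i
      ... | inj₁ l≤i = subst (Q ∘ w) (sym (jump-≤ i d l≤i)) (int l 1≤l (≤-<-trans l≤i i<k))
      ... | inj₂ i<l = subst (Q ∘ w) (sym (jump-> i d i<l))
                         (int (l + d) (≤-trans 1≤l (m≤m+n l d)) (shifted<k l<k∸d))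

  module _ {a b : V} {Q : V → Set} where
    shortest-IsMinimal : ∀ {k w} → IsWalk k w a b → Interior k w Q →
      (∀ k′ → k′ < k → ¬ WalkVia Q a b k′) → IsMinimal k w
    shortest-IsMinimal walk int shortest i j 1+i<j j≤k chord =
      let k′ , k′<k , shorter = shortcut {Q = Q} walk int 1+i<j j≤k chord
      in shortest k′ k′<k shorter

    minimise : ExcludedMiddle 0ℓ → ∀ {k w} → IsWalk k w a b → Interior k w Q →
      ∃[ k′ ] ∃[ w′ ] (IsWalk k′ w′ a b × IsMinimal k′ w′ × Interior k′ w′ Q)
    minimise lem {w = w} walk int =
      let k′ , ((w′ , walk′ , int′) , shortest) , _ = least-below lem {WalkVia Q a b} (w , walk , int)
      in k′ , w′ , walk′ , shortest-IsMinimal walk′ int′ shortest , int′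

module Endpoints (G : IntervalGraph) where
  open IntervalGraph G

  <L-strictTotalOrder : StrictTotalOrder 0ℓ 0ℓ 0ℓ
  <L-strictTotalOrder = record { isStrictTotalOrder = <L-isStrictTotalOrder }

  open StrictTotalOrder <L-strictTotalOrder using (compare; irrefl; strictPartialOrder)
  open StrictReasoning strictPartialOrder

  ≮⇒≥ : ∀ {a b} → ¬ b <L a → a ≤L b
  ≮⇒≥ {a} {b} b≮a with compare a b
  ... | tri< a<b _ _ = inj₁ a<b
  ... | tri≈ _ a≡b _ = inj₂ a≡b
  ... | tri> _ _ b<a = contradiction b<a b≮a

  <F-irrefl : ∀ {w} → ¬ w <F w
  <F-irrefl {w} w<w = irrefl refl (begin-strict fR w <⟨ w<w ⟩ fL w ≤⟨ fL≤fR w ⟩ fR w ∎)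

  <F-trans-via : ∀ {a b c d} → a <F b → ¬ c <F b → c <F d → a <F d
  <F-trans-via {a} {b} {c} {d} a<b c≮b c<d =
    begin-strict fR a <⟨ a<b ⟩ fL b ≤⟨ ≮⇒≥ c≮b ⟩ fR c <⟨ c<d ⟩ fL d ∎

  <F-trans : ∀ {a b c} → a <F b → b <F c → a <F c
  <F-trans a<b b<c = <F-trans-via a<b <F-irrefl b<c

  module _ (rep : IsRepresentation G) where
    E⇒¬<F : ∀ {a b} → a E b → ¬ a <F b
    E⇒¬<F {a} {b} aEb a<b with proj₁ (rep a b) aEb
    ... | ℓ , (_ , ℓ≤fRa) , (fLb≤ℓ , _) =
      irrefl refl (begin-strict fR a <⟨ a<b ⟩ fL b ≤⟨ fLb≤ℓ ⟩ ℓ ≤⟨ ℓ≤fRa ⟩ fR a ∎)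

    fL≤fL∧¬<F⇒E : ∀ {a b} → fL a ≤L fL b → ¬ a <F b → a E b
    fL≤fL∧¬<F⇒E {a} {b} fLa≤fLb a≮b =
      proj₂ (rep a b) (fL b , (fLa≤fLb , ≮⇒≥ a≮b) , (inj₂ refl , fL≤fR b))

    ¬<F⇒E : ∀ {a b} → ¬ a <F b → ¬ b <F a → a E b
    ¬<F⇒E {a} {b} a≮b b≮a with StrictToNonStrict.total _≡_ _<L_ compare (fL a) (fL b)
    ... | inj₁ fLa≤fLb = fL≤fL∧¬<F⇒E fLa≤fLb a≮b
    ... | inj₂ fLb≤fLa = E-sym (fL≤fL∧¬<F⇒E fLb≤fLa b≮a)

    ¬E⇒<F⊎>F : ExcludedMiddle 0ℓ → ∀ {a b} → ¬ a E b → a <F b ⊎ b <F a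
    ¬E⇒<F⊎>F lem {a} {b} a≁b with lem {a <F b} | lem {b <F a}
    ... | yes a<b | _       = inj₁ a<b
    ... | no _    | yes b<a = inj₂ b<a
    ... | no a≮b  | no b≮a  = contradiction (¬<F⇒E a≮b b≮a) a≁b

module Levels (G : IntervalGraph) {v u : IntervalGraph.V G} (v≁u : ¬ IntervalGraph._E_ G v u) where
  open IntervalGraph G

  B-suc : ∀ {k w} → B v u k w → B v u (suc k) w
  B-suc {zero}  (inj₁ refl) = v , u , inj₁ refl , inj₂ refl , E-refl v , v≁u ∘ E-sym
  B-suc {zero}  (inj₂ refl) = u , v , inj₂ refl , inj₁ refl , E-refl u , v≁u
  B-suc {suc k} {w} w∈B@(_ , y′ , _ , y′∈B , _ , y′≁w) =
    w , y′ , w∈B , B-suc y′∈B , E-refl w , y′≁w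

  B-mono : ∀ {k n w} → k ≤ n → B v u k w → B v u n w
  B-mono = go ∘ ≤⇒≤′
    where
    go : ∀ {k n w} → k ≤′ n → B v u k w → B v u n w
    go ≤′-refl       = id
    go (≤′-step k≤n) = B-suc ∘ go k≤n

  v∈B : ∀ n → B v u n v
  v∈B n = B-mono z≤n (inj₁ refl)

  u∈B : ∀ n → B v u n u
  u∈B n = B-mono z≤n (inj₂ refl)

module LevelWalks (G : IntervalGraph) (v u : IntervalGraph.V G) where
  open IntervalGraph G
  open Walks G

  Below : ℕ → (V → V → Set) → V → V → Set
  Below n R s y = B v u n y × R y s

  WalkBelow : ℕ → (V → V → Set) → V → V → Set
  WalkBelow n R a b = ∃[ s ] (B v u n s × ∃[ k ] WalkVia (Below n R s) a b k)

  WalkBelow-reverse : ∀ {n R a b} → WalkBelow n R a b → WalkBelow n R b a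
  WalkBelow-reverse {n} {R} (s , s∈B , k , w , walk , int) =
    s , s∈B , k , reverse k w , IsWalk-reverse walk , Interior-reverse {Q = Below n R s} int

  MinimalWalkBelow : ℕ → (V → V → Set) → V → V → Set
  MinimalWalkBelow m R a b = ∃[ k ] ∃[ w ] (IsWalk k w a b × IsMinimal k w ×
    ∃[ s ] ∃[ es ] (IsE v u s es × es < m ×
      (∀ i → 1 ≤ i → i < k → (∃[ ei ] (IsE v u (w i) ei × ei < m)) × R (w i) s)))

  index-below : ExcludedMiddle 0ℓ → ∀ {m n w} → n < m → B v u n w → ∃[ e ] (IsE v u w e × e < m)
  index-below lem n<m w∈B =
    let e , e-least , e≤n = least-below lem w∈B in e , e-least , ≤-<-trans e≤n n<m

  minimal-WalkBelow : ExcludedMiddle 0ℓ → ∀ {m n R a b} → n < m →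
                      WalkBelow n R a b → MinimalWalkBelow m R a b
  minimal-WalkBelow lem {n = n} {R} n<m (s , s∈B , k , w , walk , int) =
    let k′ , w′ , walk′ , minimal , int′ = minimise {Q = Below n R s} lem walk int
        es , s-least , es<m = index-below lem n<m s∈B
    in k′ , w′ , walk′ , minimal , s , es , s-least , es<m ,
       λ i 1≤i i<k′ → let wᵢ∈B , wᵢRs = int′ i 1≤i i<k′ in index-below lem n<m wᵢ∈B , wᵢRs

-- Reversing the order of L turns F(a) <_L F(b) into F(b) <_L F(a), while V and E,
-- hence walks and the sets Bₙ, are untouched.
mirror : IntervalGraph → IntervalGraph
mirror G = record
  { V = V ; _E_ = _E_ ; E-refl = E-refl ; E-sym = E-sym
  ; L = L ; _<L_ = flip _<L_
  ; <L-isStrictTotalOrder = Flip.isStrictTotalOrder <L-isStrictTotalOrder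
  ; fL = fR ; fR = fL
  ; fL≤fR = λ w → Sum.map₂ sym (fL≤fR w)
  }
  where open IntervalGraph G

mirror-IsRepresentation : ∀ {G} → IsRepresentation G → IsRepresentation (mirror G)
mirror-IsRepresentation {G} rep w w′ =
  (λ wEw′ → let ℓ , ℓ∈w , ℓ∈w′ = proj₁ (rep w w′) wEw′ in ℓ , flip-∈F ℓ∈w , flip-∈F ℓ∈w′) ,
  (λ (ℓ , ℓ∈w , ℓ∈w′) → proj₂ (rep w w′) (ℓ , unflip-∈F ℓ∈w , unflip-∈F ℓ∈w′))
  where
  open IntervalGraph G
  module Mirror = IntervalGraph (mirror G)
  flip-∈F : ∀ {ℓ w} → ℓ ∈F w → ℓ Mirror.∈F w
  flip-∈F (fLw≤ℓ , ℓ≤fRw) = Sum.map₂ sym ℓ≤fRw , Sum.map₂ sym fLw≤ℓ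
  unflip-∈F : ∀ {ℓ w} → ℓ Mirror.∈F w → ℓ ∈F w
  unflip-∈F (fRw≥ℓ , ℓ≥fLw) = Sum.map₂ sym ℓ≥fLw , Sum.map₂ sym fRw≥ℓ

module MirrorLevels (G : IntervalGraph) where
  open IntervalGraph G
  private module Mirror = IntervalGraph (mirror G)

  B⇒mirror-B : ∀ {v u} n {w} → B v u n w → Mirror.B u v n w
  B⇒mirror-B zero = Sum.swap
  B⇒mirror-B (suc n) (y , y′ , y∈B , y′∈B , yEw , y′≁w) =
    y , y′ , B⇒mirror-B n y∈B , B⇒mirror-B n y′∈B , yEw , y′≁w

  mirror-B⇒B : ∀ {v u} n {w} → Mirror.B u v n w → B v u n w
  mirror-B⇒B zero = Sum.swap
  mirror-B⇒B (suc n) (y , y′ , y∈B , y′∈B , yEw , y′≁w) =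
    y , y′ , mirror-B⇒B n y∈B , mirror-B⇒B n y′∈B , yEw , y′≁w

  module _ {v u : V} where
    open Walks G
    open LevelWalks (mirror G) u v renaming (WalkBelow to MirrorWalkBelow) using ()
    open LevelWalks G v u

    WalkBelow-unmirror : ∀ {n a b} → MirrorWalkBelow n Mirror._<F_ a b → WalkBelow n (flip _<F_) a b
    WalkBelow-unmirror {n} (s , s∈B , k , w , walk , int) =
      s , mirror-B⇒B n s∈B , k , w , walk ,
      Interior-map {Q = Mirror.B u v n ∩ (Mirror._<F s)}
        (λ (y∈B , s<y) → mirror-B⇒B n y∈B , s<y) int

module Descent (lem : ExcludedMiddle 0ℓ) (G : IntervalGraph) (rep : IsRepresentation G)
  {v u : IntervalGraph.V G} (v≁u : ¬ IntervalGraph._E_ G v u) (v<u : IntervalGraph._<F_ G v u)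
  {x : IntervalGraph.V G} (v≮x : ¬ IntervalGraph._<F_ G v x) (z : IntervalGraph.V G) where
  open IntervalGraph G
  open Walks G
  open Endpoints G
  open Levels G v≁u
  open LevelWalks G v u

  record Trail (n : ℕ) (c : V) : Set where
    field
      len       : ℕ
      path      : ℕ → V
      walk      : IsWalk len path c z
      left-of-x : ∀ i → i ≤ len → path i <F x
      in-B      : ∀ i → i < len → B v u n (path i)

  Trail-head<x : ∀ {n c} → Trail n c → c <F x
  Trail-head<x T = subst (_<F x) (proj₁ walk) (left-of-x 0 z≤n)
    where open Trail T

  Trail-start : ∀ {n} → z <F x → Trail n z
  Trail-start z<x = record
    { len       = 0
    ; path      = λ _ → z
    ; walk      = refl , refl , (λ _ ())
    ; left-of-x = λ _ _ → z<x
    ; in-B      = λ _ ()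
    }

  Trail-extend : ∀ {n c d} → d E c → d <F x → B v u n d → Trail n c → Trail n d
  Trail-extend dEc d<x d∈B T = record
    { len       = suc len
    ; path      = cons _ path
    ; walk      = IsWalk-cons dEc walk
    ; left-of-x = λ { zero _ → d<x ; (suc i) (s≤s i≤len) → left-of-x i i≤len }
    ; in-B      = λ { zero _ → d∈B ; (suc i) (s≤s i<len) → in-B i i<len }
    }
    where open Trail T

  close : ∀ {n c d s} → Trail n c → d E c → ¬ d <F x → B v u n d → B v u n s → d <F s →
          WalkBelow n _<F_ x z
  close {n} {c} {d} {s} T dEc d≮x d∈B s∈B d<s =
    s , s∈B , suc (suc len) , cons x (cons d path) , IsWalk-cons xEd (IsWalk-cons dEc walk) , interior
    where
    open Trail T
    xEd : x E d
    xEd = ¬<F⇒E rep (λ x<d → E⇒¬<F rep (E-sym dEc) (<F-trans (Trail-head<x T) x<d)) d≮x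
    interior : Interior (suc (suc len)) (cons x (cons d path)) (Below n _<F_ s)
    interior (suc zero)    _ _                   = d∈B , d<s
    interior (suc (suc i)) _ (s≤s (s≤s i<len)) =
      in-B i i<len , <F-trans-via (left-of-x i (<⇒≤ i<len)) d≮x d<s

  descend : ∀ {n} k → k ≤ n → ∀ {c d} → B v u k d → Trail n c → ¬ c <F d → WalkBelow n _<F_ x z
  descend zero _ (inj₁ refl) T c≮v = close T vEc v≮x (v∈B _) (u∈B _) v<u
    where vEc = ¬<F⇒E rep (λ v<c → v≮x (<F-trans v<c (Trail-head<x T))) c≮v
  descend zero _ (inj₂ refl) T c≮u = contradiction (<F-trans-via (Trail-head<x T) v≮x v<u) c≮u
  descend (suc k) k<n {c} {d} d∈B@(y , y′ , y∈B , y′∈B , yEd , y′≁d) T c≮d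
    with lem {d E c} | lem {d <F x}
  ... | no d≁c | _ = descend k (<⇒≤ k<n) y∈B T c≮y
    where
    d<c : d <F c
    d<c with ¬E⇒<F⊎>F rep lem d≁c
    ... | inj₁ d<c = d<c
    ... | inj₂ c<d = contradiction c<d c≮d
    c≮y : ¬ c <F y
    c≮y c<y = E⇒¬<F rep (E-sym yEd) (<F-trans d<c c<y)
  ... | yes dEc | yes d<x =
    descend k (<⇒≤ k<n) y∈B (Trail-extend dEc d<x (B-mono k<n d∈B) T) (E⇒¬<F rep (E-sym yEd))
  ... | yes dEc | no d≮x with ¬E⇒<F⊎>F rep lem y′≁d
  ...   | inj₁ y′<d = descend k (<⇒≤ k<n) y′∈B T (λ c<y′ → c≮d (<F-trans c<y′ y′<d))
  ...   | inj₂ d<y′ = close T dEc d≮x (B-mono k<n d∈B) (B-mono (<⇒≤ k<n) y′∈B) d<y′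

  WalkBelow-x-z : ∀ {m} → B v u m z → z <F x → ∃[ n ] (n < m × WalkBelow n _<F_ x z)
  WalkBelow-x-z {zero}  (inj₁ refl) v<x = contradiction v<x v≮x
  WalkBelow-x-z {zero}  (inj₂ refl) u<x = contradiction (<F-trans v<u u<x) v≮x
  WalkBelow-x-z {suc n} (t , _ , t∈B , _ , tEz , _) z<x =
    n , ≤-refl , descend n ≤-refl t∈B (Trail-start z<x) (E⇒¬<F rep (E-sym tEz))

proposition3p10 : ExcludedMiddle 0ℓ →
    (G : IntervalGraph) → IsRepresentation G → IntervalGraph.Connected G →
    let open IntervalGraph G in
    (v u : V) → ¬ (v E u) → v <F u →
    (x z : V) → (ex ez : ℕ) → IsE v u x ex → IsE v u z ez →
    let m = ex ⊔ ez in
    ((z <F x) → ¬ (v <F x) →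
      ∃[ k ] ∃[ w ] (IsWalk k w z x × IsMinimal k w ×
        ∃[ s ] ∃[ es ] (IsE v u s es × es < m ×
          (∀ i → 1 ≤ i → i < k →
            (∃[ ei ] (IsE v u (w i) ei × ei < m)) × (w i <F s)))))
    ×
    ((x <F z) → ¬ (x <F u) →
      ∃[ k ] ∃[ w ] (IsWalk k w x z × IsMinimal k w ×
        ∃[ s ] ∃[ es ] (IsE v u s es × es < m ×
          (∀ i → 1 ≤ i → i < k →
            (∃[ ei ] (IsE v u (w i) ei × ei < m)) × (s <F w i)))))
proposition3p10 lem G rep _ v u v≁u v<u x z ex ez _ (z∈B , _) = leftward , rightward
  where
  open IntervalGraph G
  open LevelWalks G v u
  z∈Bₘ : B v u (ex ⊔ ez) z
  z∈Bₘ = Levels.B-mono G v≁u (m≤n⊔m ex ez) z∈B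
  leftward : z <F x → ¬ v <F x → MinimalWalkBelow (ex ⊔ ez) _<F_ z x
  leftward z<x v≮x =
    let n , n<m , below = Descent.WalkBelow-x-z lem G rep v≁u v<u v≮x z z∈Bₘ z<x
    in minimal-WalkBelow lem {R = _<F_} n<m (WalkBelow-reverse {R = _<F_} below)
  rightward : x <F z → ¬ x <F u → MinimalWalkBelow (ex ⊔ ez) (flip _<F_) x z
  rightward x<z x≮u =
    let n , n<m , below = Descent.WalkBelow-x-z lem (mirror G) (mirror-IsRepresentation {G} rep)
                            (v≁u ∘ E-sym) v<u x≮u z (MirrorLevels.B⇒mirror-B G _ z∈Bₘ) x<z
    in minimal-WalkBelow lem {R = flip _<F_} n<m (MirrorLevels.WalkBelow-unmirror G below)
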